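{- For all integers $n$ and all $k \ge 2$, $$|S_n(12\ldots k, 132, 213)| = F_{k-1,n+1},$$ and $$\sum_{n=0}^\infty |S_n(12\ldots k, 132, 213)| x^n = \frac{1}{1 - x - x^2 - \cdots - x^{k-1}}.$$
   Context: $S_n$ is the set of permutations of $\{1,\dots,n\}$ in one-line notation. A permutation $\pi \in S_n$ contains $\sigma \in S_k$ if there are indices $i_1<\cdots<i_k$ with $\pi(i_s)<\pi(i_t)$ iff $\sigma(s)<\sigma(t)$; otherwise $\pi$ avoids $\sigma$. $S_n(R)$ is the set of $\pi \in S_n$ avoiding every element of $R$; $S_0(R)$ contains only the empty permutation and $S_n(R)=\emptyset$ for $n<0$. $12\ldots k$ is the identity permutation in $S_k$. For $k\ge1$, $F_{k,n}=0$ for $n\le 0$, $F_{k,1}=1$, and $F_{k,n}=\sum_{i=1}^k F_{k,n-i}$ for $n \ge 2$. -}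

module Defs where

open import Data.Nat as ℕ using (ℕ)
open import Data.Integer as ℤ using (ℤ; +_; -[1+_])
open import Data.Fin using (Fin; toℕ; zero; suc) renaming (_<_ to _<ᶠ_)
open import Data.Fin.Base using (fromℕ<)
open import Data.Vec using (Vec; lookup; allFin; []; _∷_)
open import Data.List using (List; []; _∷_; take)
open import Data.Nat.ListAction using (sum)
open import Data.Product using (Σ; ∃; _×_)
open import Data.Empty using (⊥)
open import Function.Definitions using (Injective)
open import Function.Bundles using (_⇔_)
open import Relation.Binary.PropositionalEquality using (_≡_)
open import Relation.Nullary using (¬_; yes; no)

-- Permutations in one-line notation: values 1..n are encoded as Fin n
-- (value v ↦ v-1).  A permutation of {1..n} is an injective vector
-- π : Vec (Fin n) n (π(i) = lookup π i).

IsPerm : ∀ {n} → Vec (Fin n) n → Set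
IsPerm {n} π = Injective _≡_ _≡_ (lookup π)

Contains : ∀ {n k} → Vec (Fin n) n → Vec (Fin k) k → Set
Contains {n} {k} π σ =
  Σ (Fin k → Fin n) λ ι →
    (∀ s t → s <ᶠ t → ι s <ᶠ ι t) ×
    (∀ s t → (lookup π (ι s) <ᶠ lookup π (ι t)) ⇔ (lookup σ s <ᶠ lookup σ t))

Avoids : ∀ {n k} → Vec (Fin n) n → Vec (Fin k) k → Set
Avoids π σ = ¬ Contains π σ

idPat : (k : ℕ) → Vec (Fin k) k
idPat k = allFin k

p132 : Vec (Fin 3) 3
p132 = zero ∷ suc (suc zero) ∷ suc zero ∷ []

p213 : Vec (Fin 3) 3
p213 = suc zero ∷ zero ∷ suc (suc zero) ∷ []

Carrier : ℤ → Set
Carrier (+ n)    = Vec (Fin n) n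
Carrier -[1+ _ ] = ⊥

InS : (k : ℕ) (n : ℤ) → Carrier n → Set
InS k (+ n) π = IsPerm π × Avoids π (idPat k) × Avoids π p132 × Avoids π p213
InS k -[1+ _ ] ()

HasCard : (A : Set) → (A → Set) → ℕ → Set
HasCard A P m =
  Σ (Fin m → A) λ f →
    Injective _≡_ _≡_ f × (∀ i → P (f i)) × (∀ x → P x → ∃ λ i → f i ≡ x)

-- k-generalized Fibonacci numbers F_{k,n}.
-- hist k m = [F_{k,m}, F_{k,m-1}, …, F_{k,0}].
hist : ℕ → ℕ → List ℕ
hist k ℕ.zero          = 0 ∷ []
hist k (ℕ.suc ℕ.zero)    = 1 ∷ 0 ∷ []
hist k (ℕ.suc (ℕ.suc m)) = sum (take k (hist k (ℕ.suc m))) ∷ hist k (ℕ.suc m)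

headOr0 : List ℕ → ℕ
headOr0 []      = 0
headOr0 (x ∷ _) = x

Fℕ : ℕ → ℕ → ℕ
Fℕ k m = headOr0 (hist k m)

F : ℕ → ℤ → ℕ
F k (+ m)     = Fℕ k m
F k -[1+ _ ]  = 0

-- Formal power series (integer coefficients) as ℕ → ℤ, Cauchy product.
sumTo : ℕ → (ℕ → ℤ) → ℤ
sumTo ℕ.zero    g = g 0
sumTo (ℕ.suc n) g = sumTo n g ℤ.+ g (ℕ.suc n)

conv : (ℕ → ℤ) → (ℕ → ℤ) → ℕ → ℤ
conv a b n = sumTo n (λ j → a j ℤ.* b (n ℕ.∸ j))

denom : ℕ → ℕ → ℤ
denom k ℕ.zero = + 1
denom k (ℕ.suc j) with ℕ.suc j ℕ.<? k
... | yes _ = ℤ.- (+ 1)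
... | no _  = + 0

one : ℕ → ℤ
one ℕ.zero    = + 1
one (ℕ.suc _) = + 0

-- A permutation avoiding 132 and 213 is a sequence of increasing runs of consecutive values, each run
-- lying entirely above the next one: its first entry v starts a run that must climb to the maximum,
-- since any other continuation creates a 132 or a 213.  Such a permutation is therefore determined by
-- the composition of n formed by its run lengths, and it avoids 12…k exactly when all parts are at
-- most k − 1.  Splitting off the first part, compositions of n into parts at most K satisfy the
-- recurrence of F_{K,n+1}, and that recurrence says precisely that the convolution of the sequence
-- with 1 − x − ⋯ − x^K is the series 1.
module Submission where

open import Defs

module Compositions where

  open import Data.Nat using (ℕ; zero; suc; _+_; _∸_; _≤_; _<_; z≤n; s≤s; _<?_; _≤?_)
  open import Data.Nat.Properties
  open import Data.Nat.Induction using (<-rec)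
  open import Algebra.Properties.CommutativeSemigroup +-commutativeSemigroup using (x∙yz≈y∙xz; xy∙z≈xz∙y)
  open import Data.List using (List; []; _∷_)
  open import Data.Product using (∃; _×_; _,_; proj₁; proj₂)
  open import Data.Sum using (_⊎_; inj₁; inj₂)
  open import Data.Empty using (⊥; ⊥-elim)
  open import Relation.Nullary using (yes; no)
  open import Relation.Binary using (tri<; tri≈; tri>)
  open import Relation.Binary.PropositionalEquality

  m+n<o⇒n<o∸m : ∀ {m n o} → m + n < o → n < o ∸ m
  m+n<o⇒n<o∸m {m} {n} {o} lt = subst (_≤ o ∸ m) (m+n∸m≡n m (suc n))
    (∸-monoˡ-≤ m (subst (_≤ o) (sym (+-suc m n)) lt))

  n<o∸m⇒m+n<o : ∀ {m n o} → m ≤ o → n < o ∸ m → m + n < o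
  n<o∸m⇒m+n<o {m} {n} {o} m≤o lt = subst (m + n <_) (m+[n∸m]≡n m≤o) (+-monoʳ-< m lt)

  below-or-shifted : ∀ h i → i < h ⊎ ∃ λ i₀ → i ≡ h + i₀
  below-or-shifted h i with i <? h
  ... | yes i<h = inj₁ i<h
  ... | no  i≮h = inj₂ (i ∸ h , sym (m+[n∸m]≡n (≮⇒≥ i≮h)))

  IsComposition : ℕ → ℕ → List ℕ → Set
  IsComposition K n []      = n ≡ 0
  IsComposition K n (h ∷ c) = 1 ≤ h × h ≤ K × h ≤ n × IsComposition K (n ∸ h) c

  -- Values are 0-based: a composition (h₁, h₂, …) of n gives the permutation whose first h₁
  -- entries are the increasing run n−h₁, …, n−1, followed by that of (h₂, …) on the values below n−h₁.
  layered : List ℕ → ℕ → ℕ → ℕ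
  layered []      n i = 0
  layered (h ∷ c) n i with i <? h
  ... | yes _ = n ∸ h + i
  ... | no  _ = layered c (n ∸ h) (i ∸ h)

  layered-head : ∀ h c n i → i < h → layered (h ∷ c) n i ≡ n ∸ h + i
  layered-head h c n i i<h with i <? h
  ... | yes _   = refl
  ... | no  i≮h = ⊥-elim (i≮h i<h)

  layered-tail : ∀ h c n i → layered (h ∷ c) n (h + i) ≡ layered c (n ∸ h) i
  layered-tail h c n i with h + i <? h
  ... | yes h+i<h = ⊥-elim (m+n≮m h i h+i<h)
  ... | no  _     = cong (layered c (n ∸ h)) (m+n∸m≡n h i)

  layered-< : ∀ {K} c n → IsComposition K n c → ∀ i → i < n → layered c n i < n
  layered-< [] n refl i ()
  layered-< (h ∷ c) n (_ , _ , h≤n , comp) i i<n with below-or-shifted h i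
  ... | inj₁ i<h rewrite layered-head h c n i i<h =
    subst (n ∸ h + i <_) (m∸n+n≡m h≤n) (+-monoʳ-< (n ∸ h) i<h)
  ... | inj₂ (i₀ , refl) rewrite layered-tail h c n i₀ =
    ≤-trans (layered-< c (n ∸ h) comp i₀ (m+n<o⇒n<o∸m i<n)) (m∸n≤m n h)

  layered-injective : ∀ {K} c n → IsComposition K n c →
    ∀ i j → i < n → j < n → layered c n i ≡ layered c n j → i ≡ j
  layered-injective [] n refl i j ()
  layered-injective (h ∷ c) n (_ , _ , _ , comp) i j i<n j<n eq
    with below-or-shifted h i | below-or-shifted h j
  ... | inj₁ i<h | inj₁ j<h
    rewrite layered-head h c n i i<h | layered-head h c n j j<h = +-cancelˡ-≡ (n ∸ h) i j eq
  ... | inj₁ i<h | inj₂ (j₀ , refl)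
    rewrite layered-head h c n i i<h | layered-tail h c n j₀ =
    ⊥-elim (<⇒≱ (layered-< c (n ∸ h) comp j₀ (m+n<o⇒n<o∸m j<n))
                (subst (n ∸ h ≤_) eq (m≤m+n (n ∸ h) i)))
  ... | inj₂ (i₀ , refl) | inj₁ j<h
    rewrite layered-tail h c n i₀ | layered-head h c n j j<h =
    ⊥-elim (<⇒≱ (layered-< c (n ∸ h) comp i₀ (m+n<o⇒n<o∸m i<n))
                (subst (n ∸ h ≤_) (sym eq) (m≤m+n (n ∸ h) j)))
  ... | inj₂ (i₀ , refl) | inj₂ (j₀ , refl)
    rewrite layered-tail h c n i₀ | layered-tail h c n j₀ =
    cong (h +_) (layered-injective c (n ∸ h) comp i₀ j₀ (m+n<o⇒n<o∸m i<n) (m+n<o⇒n<o∸m j<n) eq)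

  layered-ascent : ∀ {K} c n → IsComposition K n c → ∀ i j → i < j → j < n →
    layered c n i < layered c n j → layered c n i + j ≡ layered c n j + i × j < i + K
  layered-ascent [] n refl i j _ ()
  layered-ascent {K} (h ∷ c) n (_ , h≤K , _ , comp) i j i<j j<n lt
    with below-or-shifted h i | below-or-shifted h j
  ... | inj₁ i<h | inj₁ j<h
    rewrite layered-head h c n i i<h | layered-head h c n j j<h =
    xy∙z≈xz∙y (n ∸ h) i j , <-≤-trans j<h (≤-trans h≤K (m≤n+m K i))
  ... | inj₁ i<h | inj₂ (j₀ , refl)
    rewrite layered-head h c n i i<h | layered-tail h c n j₀ =
    ⊥-elim (<-asym lt (<-≤-trans (layered-< c (n ∸ h) comp j₀ (m+n<o⇒n<o∸m j<n)) (m≤m+n (n ∸ h) i)))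
  ... | inj₂ (i₀ , refl) | inj₁ j<h = ⊥-elim (<-asym i<j (<-≤-trans j<h (m≤m+n h i₀)))
  ... | inj₂ (i₀ , refl) | inj₂ (j₀ , refl)
    rewrite layered-tail h c n i₀ | layered-tail h c n j₀
    with layered-ascent c (n ∸ h) comp i₀ j₀ (+-cancelˡ-< h i₀ j₀ i<j) (m+n<o⇒n<o∸m j<n) lt
  ... | balanced , short = shift balanced , subst (h + j₀ <_) (sym (+-assoc h i₀ K)) (+-monoʳ-< h short)
    where
    shift : ∀ {x y} → x + j₀ ≡ y + i₀ → x + (h + j₀) ≡ y + (h + i₀)
    shift {x} {y} eq = begin
      x + (h + j₀)  ≡⟨ x∙yz≈y∙xz x h j₀ ⟩
      h + (x + j₀)  ≡⟨ cong (h +_) eq ⟩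
      h + (y + i₀)  ≡⟨ x∙yz≈y∙xz h y i₀ ⟩
      y + (h + i₀)  ∎
      where open ≡-Reasoning

  layered-≗⇒≡ : ∀ {K} c c′ n → IsComposition K n c → IsComposition K n c′ →
    (∀ i → i < n → layered c n i ≡ layered c′ n i) → c ≡ c′
  layered-≗⇒≡ [] [] n _ _ _ = refl
  layered-≗⇒≡ [] (h ∷ _) n refl (1≤h , _ , h≤n , _) _ = ⊥-elim (<⇒≱ 1≤h h≤n)
  layered-≗⇒≡ (h ∷ _) [] n (1≤h , _ , h≤n , _) refl _ = ⊥-elim (<⇒≱ 1≤h h≤n)
  layered-≗⇒≡ (h ∷ c) (h′ ∷ c′) n (1≤h , _ , h≤n , comp) (1≤h′ , _ , h′≤n , comp′) same
    with heads-equal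
    where
    heads-equal : h ≡ h′
    heads-equal = ∸-cancelˡ-≡ h≤n h′≤n (+-cancelʳ-≡ 0 (n ∸ h) (n ∸ h′)
      (trans (sym (layered-head h c n 0 1≤h)) (trans (same 0 (≤-trans 1≤h h≤n)) (layered-head h′ c′ n 0 1≤h′))))
  ... | refl = cong (h ∷_) (layered-≗⇒≡ c c′ (n ∸ h) comp comp′ λ i i<n∸h →
    trans (sym (layered-tail h c n i)) (trans (same (h + i) (n<o∸m⇒m+n<o h≤n i<n∸h)) (layered-tail h c′ n i)))

  IsRun : (ℕ → ℕ) → ℕ → ℕ → Set
  IsRun p a r = ∀ s → s < r → p (a + s) ≡ p a + s

  InjectiveBelow : ℕ → (ℕ → ℕ) → Set
  InjectiveBelow e p = ∀ i j → i < e → j < e → p i ≡ p j → i ≡ j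

  Free132 : ℕ → (ℕ → ℕ) → Set
  Free132 e p = ∀ x y z → x < y → y < z → z < e → p x < p z → p z < p y → ⊥

  Free213 : ℕ → (ℕ → ℕ) → Set
  Free213 e p = ∀ x y z → x < y → y < z → z < e → p y < p x → p x < p z → ⊥

  RunsAtMost : ℕ → ℕ → (ℕ → ℕ) → Set
  RunsAtMost K e p = ∀ i → i + K < e → IsRun p i (suc K) → ⊥

  SuffixFills : ℕ → (ℕ → ℕ) → ℕ → ℕ → Set
  SuffixFills e p a L =
    (∀ i → a ≤ i → i < e → p i < L) × (∀ w → w < L → ∃ λ i → a ≤ i × i < e × p i ≡ w)

  -- Of an injective sequence free of 132, 213 and long runs, the first entry v starts a run v, v+1, …
  -- that must climb to the largest value; the remaining entries then carry the values below v.
  module Decomposition (K : ℕ) (p : ℕ → ℕ) (e : ℕ) (p-injective : InjectiveBelow e p)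
    (no132 : Free132 e p) (no213 : Free213 e p) (noLongRun : RunsAtMost K e p) where

    module FirstBlock (a L : ℕ) (a+L≡e : a + L ≡ e) (fills : SuffixFills e p a L) (a<e : a < e) where

      v : ℕ
      v = p a

      j : ℕ
      j = L ∸ v

      v<L : v < L
      v<L = proj₁ fills a ≤-refl a<e

      v+j≡L : v + j ≡ L
      v+j≡L = m+[n∸m]≡n (<⇒≤ v<L)

      run-at : ∀ {r} → IsRun p a r → ∀ {i} → a ≤ i → i < a + r → p i ≡ v + (i ∸ a)
      run-at {r} run {i} a≤i i<a+r = begin
        p i              ≡⟨ cong p (sym a+s≡i) ⟩
        p (a + (i ∸ a))  ≡⟨ run (i ∸ a) s<r ⟩
        v + (i ∸ a)      ∎
        where
        open ≡-Reasoning
        a+s≡i : a + (i ∸ a) ≡ i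
        a+s≡i = m+[n∸m]≡n a≤i
        s<r : i ∸ a < r
        s<r = +-cancelˡ-< a (i ∸ a) r (subst (_< a + r) (sym a+s≡i) i<a+r)

      run-only : ∀ {r} → IsRun p a r → a + r ≤ e → ∀ {i} → i < e → v ≤ p i → p i < v + r → i < a + r
      run-only {r} run a+r≤e {i} i<e v≤pi pi<v+r = subst (_< a + r) a+s≡i (+-monoʳ-< a s<r)
        where
        s : ℕ
        s = p i ∸ v
        v+s≡pi : v + s ≡ p i
        v+s≡pi = m+[n∸m]≡n v≤pi
        s<r : s < r
        s<r = +-cancelˡ-< v s r (subst (_< v + r) (sym v+s≡pi) pi<v+r)
        a+s≡i : a + s ≡ i
        a+s≡i = p-injective (a + s) i (<-≤-trans (+-monoʳ-< a s<r) a+r≤e) i<e (trans (run s s<r) v+s≡pi)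

      -- With y = a + r and w = v + r: the value w sits at some u ≥ a.  If u < y it lies in the run, whose
      -- values are below w; if u > y, then p y > w makes a, y, u a 132, p y < v makes them a 213, and
      -- v ≤ p y < w puts y inside the run.
      run-extends : ∀ r → IsRun p a r → r < j → p (a + r) ≡ v + r
      run-extends zero _ _ = trans (cong p (+-identityʳ a)) (sym (+-identityʳ v))
      run-extends r@(suc _) run r<j with proj₂ fills (v + r) (n<o∸m⇒m+n<o (<⇒≤ v<L) r<j)
      ... | u , a≤u , u<e , pu≡w with <-cmp u (a + r)
      ...   | tri≈ _ u≡y _ = trans (cong p (sym u≡y)) pu≡w
      ...   | tri< u<y _ _ = ⊥-elim (<-irrefl pu≡w (begin-strict
        p u          ≡⟨ run-at run a≤u u<y ⟩
        v + (u ∸ a)  <⟨ +-monoʳ-< v (m<n+o⇒m∸n<o u a u<y) ⟩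
        v + r        ∎))
        where open ≤-Reasoning
      ...   | tri> _ _ y<u with <-cmp (p (a + r)) (v + r)
      ...     | tri≈ _ py≡w _ =
        ⊥-elim (<-irrefl (p-injective _ _ (<-trans y<u u<e) u<e (trans py≡w (sym pu≡w))) y<u)
      ...     | tri> _ _ w<py = ⊥-elim (no132 a (a + r) u a<y y<u u<e
                                  (subst (v <_) (sym pu≡w) v<w) (subst (_< p (a + r)) (sym pu≡w) w<py))
        where
        a<y : a < a + r
        a<y = m<m+n a (s≤s z≤n)
        v<w : v < v + r
        v<w = m<m+n v (s≤s z≤n)
      ...     | tri< py<w _ _ with v ≤? p (a + r)
      ...       | no  v≰py = ⊥-elim (no213 a (a + r) u (m<m+n a (s≤s z≤n)) y<u u<e (≰⇒> v≰py)
                                    (subst (v <_) (sym pu≡w) (m<m+n v (s≤s z≤n))))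
      ...       | yes v≤py =
        ⊥-elim (<-irrefl refl (run-only run (<⇒≤ (<-trans y<u u<e)) (<-trans y<u u<e) v≤py py<w))

      run : ∀ r → r ≤ j → IsRun p a r
      run zero    _   s ()
      run (suc r) r<j s s<1+r with m<1+n⇒m<n∨m≡n s<1+r
      ... | inj₁ s<r  = run r (<⇒≤ r<j) s s<r
      ... | inj₂ refl = run-extends r (run r (<⇒≤ r<j)) r<j

      firstBlock : IsRun p a j
      firstBlock = run j ≤-refl

      1≤j : 1 ≤ j
      1≤j = m<n⇒0<n∸m v<L

      j≤L : j ≤ L
      j≤L = m∸n≤m L v

      a+j≤e : a + j ≤ e
      a+j≤e = subst (a + j ≤_) a+L≡e (+-monoʳ-≤ a j≤L)

      j≤K : j ≤ K
      j≤K with j ≤? K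
      ... | yes j≤K = j≤K
      ... | no  j≰K = ⊥-elim (noLongRun a (<-≤-trans (+-monoʳ-< a (≰⇒> j≰K)) a+j≤e)
                                 λ s s<1+K → firstBlock s (<-≤-trans s<1+K (≰⇒> j≰K)))

      rest-fills : SuffixFills e p (a + j) v
      rest-fills = below , onto
        where
        below : ∀ i → a + j ≤ i → i < e → p i < v
        below i a+j≤i i<e with p i <? v
        ... | yes pi<v = pi<v
        ... | no  pi≮v = ⊥-elim (<⇒≱ (run-only firstBlock a+j≤e i<e (≮⇒≥ pi≮v) pi<v+j) a+j≤i)
          where
          pi<v+j : p i < v + j
          pi<v+j = subst (p i <_) (sym v+j≡L) (proj₁ fills i (≤-trans (m≤m+n a j) a+j≤i) i<e)
        onto : ∀ w → w < v → ∃ λ i → a + j ≤ i × i < e × p i ≡ w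
        onto w w<v with proj₂ fills w (<-trans w<v v<L)
        ... | i , a≤i , i<e , pi≡w with a + j ≤? i
        ...   | yes a+j≤i = i , a+j≤i , i<e , pi≡w
        ...   | no  a+j≰i = ⊥-elim (<⇒≱ w<v (begin
          v            ≤⟨ m≤m+n v (i ∸ a) ⟩
          v + (i ∸ a)  ≡⟨ run-at firstBlock a≤i (≰⇒> a+j≰i) ⟨
          p i          ≡⟨ pi≡w ⟩
          w            ∎))
          where open ≤-Reasoning

    Decomposes : ℕ → Set
    Decomposes L = ∀ a → a + L ≡ e → SuffixFills e p a L →
      ∃ λ c → IsComposition K L c × (∀ i → i < L → p (a + i) ≡ layered c L i)

    decomposes-step : ∀ L → (∀ {L′} → L′ < L → Decomposes L′) → Decomposes L
    decomposes-step zero _ a _ _ = [] , refl , λ i ()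
    decomposes-step L@(suc _) decomposes-below a a+L≡e fills = j ∷ c , (1≤j , j≤K , j≤L , c-composes) , agree
      where
      a<e : a < e
      a<e = subst (a <_) a+L≡e (m<m+n a (s≤s z≤n))
      open FirstBlock a L a+L≡e fills a<e
      L∸j≡v : L ∸ j ≡ v
      L∸j≡v = m∸[m∸n]≡n (<⇒≤ v<L)
      j+v≡L : j + v ≡ L
      j+v≡L = trans (+-comm j v) v+j≡L
      rest : ∃ λ c → IsComposition K v c × (∀ i → i < v → p (a + j + i) ≡ layered c v i)
      rest = decomposes-below v<L (a + j) (trans (+-assoc a j v) (trans (cong (a +_) j+v≡L) a+L≡e)) rest-fills
      c : List ℕ
      c = proj₁ rest
      c-composes : IsComposition K (L ∸ j) c
      c-composes = subst (λ m → IsComposition K m c) (sym L∸j≡v) (proj₁ (proj₂ rest))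
      agree : ∀ i → i < L → p (a + i) ≡ layered (j ∷ c) L i
      agree i i<L with below-or-shifted j i
      ... | inj₁ i<j = begin
        p (a + i)              ≡⟨ firstBlock i i<j ⟩
        v + i                  ≡⟨ cong (_+ i) (sym L∸j≡v) ⟩
        L ∸ j + i              ≡⟨ layered-head j c L i i<j ⟨
        layered (j ∷ c) L i    ∎
        where open ≡-Reasoning
      ... | inj₂ (i₀ , refl) = begin
        p (a + (j + i₀))             ≡⟨ cong p (+-assoc a j i₀) ⟨
        p (a + j + i₀)               ≡⟨ proj₂ (proj₂ rest) i₀ i₀<v ⟩
        layered c v i₀               ≡⟨ cong (λ m → layered c m i₀) L∸j≡v ⟨
        layered c (L ∸ j) i₀         ≡⟨ layered-tail j c L i₀ ⟨
        layered (j ∷ c) L (j + i₀)   ∎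
        where
        open ≡-Reasoning
        i₀<v : i₀ < v
        i₀<v = +-cancelˡ-< j i₀ v (subst (j + i₀ <_) (sym j+v≡L) i<L)

    decompose : ∀ L → Decomposes L
    decompose = <-rec Decomposes decomposes-step

module LayeredPermutations where

  open import Data.Nat using (ℕ; zero; suc; _+_; _≤_; _<_; z≤n; s≤s; s≤s⁻¹; _<?_)
  open import Data.Nat.Properties
  open import Data.Integer using (+_)
  open import Data.Fin using (Fin; toℕ; fromℕ<; fromℕ; zero; suc; punchOut) renaming (_<_ to _<ᶠ_)
  open import Data.Fin.Properties
    using (toℕ-fromℕ<; fromℕ<-injective; toℕ-injective; toℕ<n; toℕ-fromℕ; fromℕ<-toℕ; any?; punchOut-injective;
           injective⇒≤)
    renaming (_≟_ to _≟ᶠ_)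
  open import Data.Vec using (Vec; lookup; tabulate; allFin)
  open import Data.Vec.Properties using (lookup∘tabulate; tabulate∘lookup; tabulate-cong; lookup-allFin)
  open import Data.List using (List)
  open import Data.Product using (∃; _×_; _,_; proj₁; proj₂)
  open import Data.Empty using (⊥; ⊥-elim)
  open import Function.Bundles using (_⇔_; mk⇔; Equivalence)
  open import Function.Definitions using (Injective)
  open import Relation.Nullary using (¬_; yes; no)
  open import Relation.Binary.PropositionalEquality
  open Compositions

  -- Out of range, toFin returns the junk default d.
  toFin : ∀ {n} → Fin n → ℕ → Fin n
  toFin {n} d x with x <? n
  ... | yes x<n = fromℕ< x<n
  ... | no  _   = d

  toℕ-toFin : ∀ {n} (d : Fin n) {x} → x < n → toℕ (toFin d x) ≡ x
  toℕ-toFin {n} d {x} x<n with x <? n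
  ... | yes x<n′ = toℕ-fromℕ< x<n′
  ... | no  x≮n  = ⊥-elim (x≮n x<n)

  layeredPerm : ∀ n → List ℕ → Vec (Fin n) n
  layeredPerm n c = tabulate λ i → toFin i (layered c n (toℕ i))

  toℕ-layeredPerm : ∀ {K} n c → IsComposition K n c →
    ∀ i → toℕ (lookup (layeredPerm n c) i) ≡ layered c n (toℕ i)
  toℕ-layeredPerm n c comp i rewrite lookup∘tabulate (λ i → toFin i (layered c n (toℕ i))) i =
    toℕ-toFin i (layered-< c n comp (toℕ i) (toℕ<n i))

  layeredPerm-isPerm : ∀ {K} n c → IsComposition K n c → IsPerm (layeredPerm n c)
  layeredPerm-isPerm n c comp {i} {j} eq = toℕ-injective (layered-injective c n comp _ _ (toℕ<n i) (toℕ<n j)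
    (trans (sym (toℕ-layeredPerm n c comp i)) (trans (cong toℕ eq) (toℕ-layeredPerm n c comp j))))

  layeredPerm-injective : ∀ {K} n c c′ → IsComposition K n c → IsComposition K n c′ →
    layeredPerm n c ≡ layeredPerm n c′ → c ≡ c′
  layeredPerm-injective n c c′ comp comp′ eq = layered-≗⇒≡ c c′ n comp comp′ λ i i<n → begin
    layered c n i                                 ≡⟨ cong (layered c n) (toℕ-fromℕ< i<n) ⟨
    layered c n (toℕ (fromℕ< i<n))                ≡⟨ toℕ-layeredPerm n c comp (fromℕ< i<n) ⟨
    toℕ (lookup (layeredPerm n c) (fromℕ< i<n))   ≡⟨ cong (λ π → toℕ (lookup π (fromℕ< i<n))) eq ⟩
    toℕ (lookup (layeredPerm n c′) (fromℕ< i<n))  ≡⟨ toℕ-layeredPerm n c′ comp′ (fromℕ< i<n) ⟩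
    layered c′ n (toℕ (fromℕ< i<n))               ≡⟨ cong (layered c′ n) (toℕ-fromℕ< i<n) ⟩
    layered c′ n i                                ∎
    where open ≡-Reasoning

  fromℕ<-mono-< : ∀ {n x y} (x<n : x < n) (y<n : y < n) → x < y → fromℕ< x<n <ᶠ fromℕ< y<n
  fromℕ<-mono-< x<n y<n = subst₂ _<_ (sym (toℕ-fromℕ< x<n)) (sym (toℕ-fromℕ< y<n))

  increasing-spread : ∀ {n} m (ι : Fin (suc m) → Fin n) → (∀ s t → s <ᶠ t → ι s <ᶠ ι t) →
    toℕ (ι zero) + m ≤ toℕ (ι (fromℕ m))
  increasing-spread zero    ι increasing = ≤-reflexive (+-identityʳ _)
  increasing-spread (suc m) ι increasing = begin
    toℕ (ι zero) + suc m    ≡⟨ +-suc (toℕ (ι zero)) m ⟩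
    suc (toℕ (ι zero)) + m  ≤⟨ +-monoˡ-≤ m (increasing zero (suc zero) (s≤s z≤n)) ⟩
    toℕ (ι (suc zero)) + m  ≤⟨ increasing-spread m (λ s → ι (suc s))
                                 (λ s t s<t → increasing (suc s) (suc t) (s≤s s<t)) ⟩
    toℕ (ι (fromℕ (suc m))) ∎
    where open ≤-Reasoning

  AscentsInShortRuns : ∀ {n} → ℕ → Vec (Fin n) n → Set
  AscentsInShortRuns {n} K π = ∀ (i j : Fin n) → i <ᶠ j → lookup π i <ᶠ lookup π j →
    toℕ (lookup π i) + toℕ j ≡ toℕ (lookup π j) + toℕ i × toℕ j < toℕ i + K

  -- Two ascents with a common endpoint compare the values at their other endpoints as the positions,
  -- which excludes 132 and 213; a 12…(K+1) would be an ascent spanning at least K.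
  module Avoidance {n} (K : ℕ) (π : Vec (Fin n) n) (ascent : AscentsInShortRuns K π) where

    P : Fin n → ℕ
    P i = toℕ (lookup π i)

    module IncreasingTriple (ι : Fin 3 → Fin n) (increasing : ∀ s t → s <ᶠ t → ι s <ᶠ ι t) where

      a b c : Fin n
      a = ι zero
      b = ι (suc zero)
      c = ι (suc (suc zero))

      a<b : a <ᶠ b
      a<b = increasing zero (suc zero) (s≤s z≤n)

      b<c : b <ᶠ c
      b<c = increasing (suc zero) (suc (suc zero)) (s≤s (s≤s z≤n))

    avoids132 : Avoids π p132
    avoids132 (ι , increasing , order) = <-irrefl refl (begin-strict
      P b + toℕ a  ≡⟨ proj₁ (ascent a b a<b (<-trans Pa<Pc Pc<Pb)) ⟨
      P a + toℕ b  <⟨ +-monoʳ-< (P a) b<c ⟩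
      P a + toℕ c  ≡⟨ proj₁ (ascent a c (<-trans a<b b<c) Pa<Pc) ⟩
      P c + toℕ a  <⟨ +-monoˡ-< (toℕ a) Pc<Pb ⟩
      P b + toℕ a  ∎)
      where
      open ≤-Reasoning
      open IncreasingTriple ι increasing
      Pa<Pc : P a < P c
      Pa<Pc = Equivalence.from (order zero (suc (suc zero))) (s≤s z≤n)
      Pc<Pb : P c < P b
      Pc<Pb = Equivalence.from (order (suc (suc zero)) (suc zero)) (s≤s (s≤s z≤n))

    avoids213 : Avoids π p213
    avoids213 (ι , increasing , order) = <-irrefl refl (begin-strict
      P a + toℕ c  ≡⟨ proj₁ (ascent a c (<-trans a<b b<c) Pa<Pc) ⟩
      P c + toℕ a  <⟨ +-monoʳ-< (P c) a<b ⟩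
      P c + toℕ b  ≡⟨ proj₁ (ascent b c b<c (<-trans Pb<Pa Pa<Pc)) ⟨
      P b + toℕ c  <⟨ +-monoˡ-< (toℕ c) Pb<Pa ⟩
      P a + toℕ c  ∎)
      where
      open ≤-Reasoning
      open IncreasingTriple ι increasing
      Pa<Pc : P a < P c
      Pa<Pc = Equivalence.from (order zero (suc (suc zero))) (s≤s (s≤s z≤n))
      Pb<Pa : P b < P a
      Pb<Pa = Equivalence.from (order (suc zero) zero) (s≤s z≤n)

    avoids-id : 1 ≤ K → Avoids π (idPat (suc K))
    avoids-id 1≤K (ι , increasing , order) =
      <⇒≱ (proj₂ (ascent (ι zero) (ι last) (increasing zero last 0<last) Pfirst<Plast))
          (increasing-spread K ι increasing)
      where
      last : Fin (suc K)
      last = fromℕ K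
      0<last : zero {K} <ᶠ last
      0<last = subst (0 <_) (sym (toℕ-fromℕ K)) 1≤K
      Pfirst<Plast : P (ι zero) < P (ι last)
      Pfirst<Plast = Equivalence.from (order zero last)
        (subst₂ _<ᶠ_ (sym (lookup-allFin {suc K} zero)) (sym (lookup-allFin last)) 0<last)

  layeredPerm-ascents : ∀ {K} n c → IsComposition K n c → AscentsInShortRuns K (layeredPerm n c)
  layeredPerm-ascents n c comp i j i<j rewrite toℕ-layeredPerm n c comp i | toℕ-layeredPerm n c comp j =
    layered-ascent c n comp (toℕ i) (toℕ j) i<j (toℕ<n j)

  layeredPerm-∈S : ∀ K n c → 1 ≤ K → IsComposition K n c → InS (suc K) (+ n) (layeredPerm n c)
  layeredPerm-∈S K n c 1≤K comp = layeredPerm-isPerm n c comp , avoids-id 1≤K , avoids132 , avoids213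
    where open Avoidance K (layeredPerm n c) (layeredPerm-ascents n c comp)

  injective⇒surjective : ∀ {n} (f : Fin n → Fin n) → Injective _≡_ _≡_ f → ∀ y → ∃ λ i → f i ≡ y
  injective⇒surjective {suc n} f f-injective y with any? (λ i → f i ≟ᶠ y)
  ... | yes hit = hit
  ... | no  miss = ⊥-elim (<-irrefl refl (injective⇒≤ {f = g} g-injective))
    where
    g : Fin (suc n) → Fin n
    g i = punchOut {i = y} {j = f i} (λ y≡fi → miss (i , sym y≡fi))
    g-injective : Injective _≡_ _≡_ g
    g-injective {i} {j} eq =
      f-injective (punchOut-injective (λ y≡fi → miss (i , sym y≡fi)) (λ y≡fj → miss (j , sym y≡fj)) eq)

  ⇔-both : ∀ {A B : Set} → A → B → A ⇔ B
  ⇔-both a b = mk⇔ (λ _ → b) (λ _ → a)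

  ⇔-neither : ∀ {A B : Set} → ¬ A → ¬ B → A ⇔ B
  ⇔-neither ¬a ¬b = mk⇔ (λ a → ⊥-elim (¬a a)) (λ b → ⊥-elim (¬b b))

  module Occurrences {n} (π : Vec (Fin n) n) where

    P : Fin n → ℕ
    P i = toℕ (lookup π i)

    triple : Fin n → Fin n → Fin n → Fin 3 → Fin n
    triple x y z zero             = x
    triple x y z (suc zero)       = y
    triple x y z (suc (suc zero)) = z

    triple-increasing : ∀ x y z → x <ᶠ y → y <ᶠ z → ∀ s t → s <ᶠ t → triple x y z s <ᶠ triple x y z t
    triple-increasing x y z x<y y<z zero       (suc zero)       _ = x<y
    triple-increasing x y z x<y y<z zero       (suc (suc zero)) _ = <-trans x<y y<z
    triple-increasing x y z x<y y<z (suc zero) (suc (suc zero)) _ = y<z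
    triple-increasing x y z x<y y<z (suc zero) (suc zero)       (s≤s ())
    triple-increasing x y z x<y y<z (suc (suc zero)) (suc zero)       (s≤s ())
    triple-increasing x y z x<y y<z (suc (suc zero)) (suc (suc zero)) (s≤s (s≤s ()))

    contains132 : ∀ x y z → x <ᶠ y → y <ᶠ z → P x < P z → P z < P y → Contains π p132
    contains132 x y z x<y y<z Px<Pz Pz<Py = triple x y z , triple-increasing x y z x<y y<z , order
      where
      order : ∀ s t → (P (triple x y z s) < P (triple x y z t)) ⇔ (lookup p132 s <ᶠ lookup p132 t)
      order zero             zero             = ⇔-neither (<-irrefl refl) (λ ())
      order zero             (suc zero)       = ⇔-both (<-trans Px<Pz Pz<Py) (s≤s z≤n)
      order zero             (suc (suc zero)) = ⇔-both Px<Pz (s≤s z≤n)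
      order (suc zero)       zero             = ⇔-neither (<-asym (<-trans Px<Pz Pz<Py)) (λ ())
      order (suc zero)       (suc zero)       = ⇔-neither (<-irrefl refl) (λ { (s≤s (s≤s ())) })
      order (suc zero)       (suc (suc zero)) = ⇔-neither (<-asym Pz<Py) (λ { (s≤s ()) })
      order (suc (suc zero)) zero             = ⇔-neither (<-asym Px<Pz) (λ ())
      order (suc (suc zero)) (suc zero)       = ⇔-both Pz<Py (s≤s (s≤s z≤n))
      order (suc (suc zero)) (suc (suc zero)) = ⇔-neither (<-irrefl refl) (λ { (s≤s ()) })

    contains213 : ∀ x y z → x <ᶠ y → y <ᶠ z → P y < P x → P x < P z → Contains π p213
    contains213 x y z x<y y<z Py<Px Px<Pz = triple x y z , triple-increasing x y z x<y y<z , order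
      where
      order : ∀ s t → (P (triple x y z s) < P (triple x y z t)) ⇔ (lookup p213 s <ᶠ lookup p213 t)
      order zero             zero             = ⇔-neither (<-irrefl refl) (λ { (s≤s ()) })
      order zero             (suc zero)       = ⇔-neither (<-asym Py<Px) (λ ())
      order zero             (suc (suc zero)) = ⇔-both Px<Pz (s≤s (s≤s z≤n))
      order (suc zero)       zero             = ⇔-both Py<Px (s≤s z≤n)
      order (suc zero)       (suc zero)       = ⇔-neither (<-irrefl refl) (λ ())
      order (suc zero)       (suc (suc zero)) = ⇔-both (<-trans Py<Px Px<Pz) (s≤s z≤n)
      order (suc (suc zero)) zero             = ⇔-neither (<-asym Px<Pz) (λ { (s≤s ()) })
      order (suc (suc zero)) (suc zero)       = ⇔-neither (<-asym (<-trans Py<Px Px<Pz)) (λ ())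
      order (suc (suc zero)) (suc (suc zero)) = ⇔-neither (<-irrefl refl) (λ { (s≤s (s≤s ())) })

    -- π read on ℕ positions, with the junk value 0 from position n on.
    valueAt : ℕ → ℕ
    valueAt i with i <? n
    ... | yes i<n = P (fromℕ< i<n)
    ... | no  _   = 0

    valueAt-fromℕ< : ∀ {i} (i<n : i < n) → valueAt i ≡ P (fromℕ< i<n)
    valueAt-fromℕ< {i} i<n with i <? n
    ... | yes _   = refl
    ... | no  i≮n = ⊥-elim (i≮n i<n)

    valueAt-toℕ : ∀ i → valueAt (toℕ i) ≡ P i
    valueAt-toℕ i = trans (valueAt-fromℕ< (toℕ<n i)) (cong P (fromℕ<-toℕ i (toℕ<n i)))

    containsId : ∀ K i → i + K < n → IsRun valueAt i (suc K) → Contains π (idPat (suc K))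
    containsId K i i+K<n run = ι , increasing , order
      where
      i+s<n : ∀ (s : Fin (suc K)) → i + toℕ s < n
      i+s<n s = ≤-<-trans (+-monoʳ-≤ i (s≤s⁻¹ (toℕ<n s))) i+K<n
      ι : Fin (suc K) → Fin n
      ι s = fromℕ< (i+s<n s)
      toℕ-ι : ∀ s → toℕ (ι s) ≡ i + toℕ s
      toℕ-ι s = toℕ-fromℕ< (i+s<n s)
      P-ι : ∀ s → P (ι s) ≡ valueAt i + toℕ s
      P-ι s = trans (sym (valueAt-fromℕ< (i+s<n s))) (run (toℕ s) (toℕ<n s))
      increasing : ∀ s t → s <ᶠ t → ι s <ᶠ ι t
      increasing s t s<t = subst₂ _<_ (sym (toℕ-ι s)) (sym (toℕ-ι t)) (+-monoʳ-< i s<t)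
      order : ∀ s t → (P (ι s) < P (ι t)) ⇔ (lookup (allFin (suc K)) s <ᶠ lookup (allFin (suc K)) t)
      order s t = mk⇔
        (λ Pιs<Pιt → subst₂ _<ᶠ_ (sym (lookup-allFin s)) (sym (lookup-allFin t))
          (+-cancelˡ-< (valueAt i) _ _ (subst₂ _<_ (P-ι s) (P-ι t) Pιs<Pιt)))
        (λ s<t → subst₂ _<_ (sym (P-ι s)) (sym (P-ι t))
          (+-monoʳ-< (valueAt i) (subst₂ _<ᶠ_ (lookup-allFin s) (lookup-allFin t) s<t)))

    module _ {x y z} (x<y : x < y) (y<z : y < z) (z<n : z < n) where

      private
        y<n : y < n
        y<n = <-trans y<z z<n
        x<n : x < n
        x<n = <-trans x<y y<n

      valueAt-free132 : Avoids π p132 → valueAt x < valueAt z → valueAt z < valueAt y → ⊥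
      valueAt-free132 avoids Px<Pz Pz<Py = avoids (contains132 _ _ _
        (fromℕ<-mono-< x<n y<n x<y) (fromℕ<-mono-< y<n z<n y<z)
        (subst₂ _<_ (valueAt-fromℕ< x<n) (valueAt-fromℕ< z<n) Px<Pz)
        (subst₂ _<_ (valueAt-fromℕ< z<n) (valueAt-fromℕ< y<n) Pz<Py))

      valueAt-free213 : Avoids π p213 → valueAt y < valueAt x → valueAt x < valueAt z → ⊥
      valueAt-free213 avoids Py<Px Px<Pz = avoids (contains213 _ _ _
        (fromℕ<-mono-< x<n y<n x<y) (fromℕ<-mono-< y<n z<n y<z)
        (subst₂ _<_ (valueAt-fromℕ< y<n) (valueAt-fromℕ< x<n) Py<Px)
        (subst₂ _<_ (valueAt-fromℕ< x<n) (valueAt-fromℕ< z<n) Px<Pz))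

    valueAt-injective : IsPerm π → InjectiveBelow n valueAt
    valueAt-injective isPerm i j i<n j<n eq = fromℕ<-injective i j i<n j<n
      (isPerm (toℕ-injective (trans (sym (valueAt-fromℕ< i<n)) (trans eq (valueAt-fromℕ< j<n)))))

    valueAt-fills : IsPerm π → SuffixFills n valueAt 0 n
    valueAt-fills isPerm = (λ i _ i<n → subst (_< n) (sym (valueAt-fromℕ< i<n)) (toℕ<n _)) , onto
      where
      onto : ∀ w → w < n → ∃ λ i → 0 ≤ i × i < n × valueAt i ≡ w
      onto w w<n with injective⇒surjective (lookup π) isPerm (fromℕ< w<n)
      ... | i , πi≡w =
        toℕ i , z≤n , toℕ<n i , trans (valueAt-toℕ i) (trans (cong toℕ πi≡w) (toℕ-fromℕ< w<n))

    layeredPerm-≡ : ∀ {K} c → IsComposition K n c →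
      (∀ i → i < n → valueAt i ≡ layered c n i) → layeredPerm n c ≡ π
    layeredPerm-≡ c comp agree = trans (tabulate-cong λ i → toℕ-injective (begin
        toℕ (toFin i (layered c n (toℕ i)))  ≡⟨ toℕ-toFin i (layered-< c n comp (toℕ i) (toℕ<n i)) ⟩
        layered c n (toℕ i)                  ≡⟨ agree (toℕ i) (toℕ<n i) ⟨
        valueAt (toℕ i)                      ≡⟨ valueAt-toℕ i ⟩
        P i                                  ∎))
      (tabulate∘lookup π)
      where open ≡-Reasoning

    S⇒layered : ∀ K → InS (suc K) (+ n) π → ∃ λ c → IsComposition K n c × layeredPerm n c ≡ π
    S⇒layered K (isPerm , avoidsId , avoids132 , avoids213) with decompose n 0 refl (valueAt-fills isPerm)
      where
      open Decomposition K valueAt n (valueAt-injective isPerm)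
        (λ x y z x<y y<z z<n → valueAt-free132 x<y y<z z<n avoids132)
        (λ x y z x<y y<z z<n → valueAt-free213 x<y y<z z<n avoids213)
        (λ i i+K<n run → avoidsId (containsId K i i+K<n run))
    ... | c , comp , agree = c , comp , layeredPerm-≡ c comp agree

module Enumeration where

  open import Data.Nat using (ℕ; zero; suc; _+_; _∸_; _≤_; _<_; z≤n; s≤s; s≤s⁻¹; _⊓_)
  open import Data.Nat.Properties
  open import Data.Nat.ListAction using (sum)
  open import Data.Integer using (+_)
  open import Data.Fin using (Fin; zero; suc)
  open import Data.Fin.Properties using (injective⇒≤; ¬Fin0)
  open import Data.Vec using (Vec)
  open import Data.List using (List; []; _∷_; length; map; _++_; take)
  import Data.List as List
  open import Data.List.Properties using (length-++; length-map; length-take; take-map)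
  open import Data.List.Membership.Propositional using (_∈_)
  open import Data.List.Membership.Propositional.Properties
    using (∈-lookup; ∈-map⁻; ∈-map⁺; ∈-++⁻; ∈-++⁺ˡ; ∈-++⁺ʳ)
  open import Data.List.Relation.Unary.Any using (here; index)
  open import Data.List.Relation.Unary.Any.Properties using (lookup-index)
  import Data.List.Relation.Unary.All as All
  open import Data.List.Relation.Unary.AllPairs using ([]; _∷_)
  open import Data.List.Relation.Unary.Unique.Propositional using (Unique)
  import Data.List.Relation.Unary.Unique.Propositional.Properties as Unique
  open import Data.Product using (∃; _×_; _,_; proj₁; proj₂)
  open import Data.Sum using (inj₁; inj₂)
  open import Data.Empty using (⊥; ⊥-elim)
  open import Function.Definitions using (Injective)
  open import Relation.Nullary using (¬_)
  open import Relation.Binary.PropositionalEquality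
  open Compositions
  open LayeredPermutations

  HasCard-image : ∀ {B A : Set} {Q : B → Set} {P : A → Set} {m} → HasCard B Q m → (g : B → A) →
    (∀ x y → Q x → Q y → g x ≡ g y → x ≡ y) → (∀ x → Q x → P (g x)) →
    (∀ a → P a → ∃ λ x → Q x × g x ≡ a) → HasCard A P m
  HasCard-image (f , f-injective , f-into , f-onto) g g-injective g-into g-onto =
    (λ i → g (f i)) ,
    (λ {i} {j} eq → f-injective (g-injective _ _ (f-into i) (f-into j) eq)) ,
    (λ i → g-into _ (f-into i)) ,
    λ a Pa → let x , Qx , gx≡a = g-onto a Pa ; i , fi≡x = f-onto x Qx in i , trans (cong g fi≡x) gx≡a

  HasCard-≤ : ∀ {A : Set} {P : A → Set} {m m′} → HasCard A P m → HasCard A P m′ → m ≤ m′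
  HasCard-≤ {m = m} {m′} (f , f-injective , f-into , _) (f′ , _ , _ , f′-onto) = injective⇒≤ reindex-injective
    where
    reindex : Fin m → Fin m′
    reindex i = proj₁ (f′-onto (f i) (f-into i))
    reindex-injective : Injective _≡_ _≡_ reindex
    reindex-injective {i} {j} eq = f-injective (begin
      f i              ≡⟨ proj₂ (f′-onto (f i) (f-into i)) ⟨
      f′ (reindex i)   ≡⟨ cong f′ eq ⟩
      f′ (reindex j)   ≡⟨ proj₂ (f′-onto (f j) (f-into j)) ⟩
      f j              ∎)
      where open ≡-Reasoning

  HasCard-unique : ∀ {A : Set} {P : A → Set} {m m′} → HasCard A P m → HasCard A P m′ → m ≡ m′
  HasCard-unique card card′ = ≤-antisym (HasCard-≤ card card′) (HasCard-≤ card′ card)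

  HasCard-⊥ : ∀ {P : ⊥ → Set} → HasCard ⊥ P 0
  HasCard-⊥ = (λ ()) , (λ {i} → ⊥-elim (¬Fin0 i)) , (λ ()) , (λ ())

  Unique⇒lookup-injective : ∀ {A : Set} {xs : List A} → Unique xs → Injective _≡_ _≡_ (List.lookup xs)
  Unique⇒lookup-injective (x∉xs ∷ unique) {zero}  {zero}  _  = refl
  Unique⇒lookup-injective (x∉xs ∷ unique) {zero}  {suc j} eq = ⊥-elim (All.lookup x∉xs (∈-lookup j) eq)
  Unique⇒lookup-injective (x∉xs ∷ unique) {suc i} {zero}  eq = ⊥-elim (All.lookup x∉xs (∈-lookup i) (sym eq))
  Unique⇒lookup-injective (x∉xs ∷ unique) {suc i} {suc j} eq = cong suc (Unique⇒lookup-injective unique eq)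

  Enumerates : ℕ → ℕ → List (List ℕ) → Set
  Enumerates K n C = Unique C × (∀ x → x ∈ C → IsComposition K n x) × (∀ x → IsComposition K n x → x ∈ C)

  Enumerates⇒HasCard : ∀ {K n C} → Enumerates K n C → HasCard (List ℕ) (IsComposition K n) (length C)
  Enumerates⇒HasCard {C = C} (unique , sound , complete) =
    List.lookup C , Unique⇒lookup-injective unique , (λ i → sound _ (∈-lookup i)) ,
    λ x comp → index (complete x comp) , sym (lookup-index (complete x comp))

  withFirstPart : ℕ → List (List (List ℕ)) → List (List ℕ)
  withFirstPart j []       = []
  withFirstPart j (C ∷ Cs) = map (j ∷_) C ++ withFirstPart (suc j) Cs

  -- Mirrors hist: compositionTable K m lists the compositions of m, m − 1, …, 0 into parts at most K.
  compositions : ℕ → ℕ → List (List ℕ)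
  compositionTable : ℕ → ℕ → List (List (List ℕ))

  compositions K zero    = [] ∷ []
  compositions K (suc m) = withFirstPart 1 (take K (compositionTable K m))

  compositionTable K zero    = compositions K zero ∷ []
  compositionTable K (suc m) = compositions K (suc m) ∷ compositionTable K m

  length-withFirstPart : ∀ j Cs → length (withFirstPart j Cs) ≡ sum (map length Cs)
  length-withFirstPart j []       = refl
  length-withFirstPart j (C ∷ Cs) =
    trans (length-++ (map (j ∷_) C)) (cong₂ _+_ (length-map (j ∷_) C) (length-withFirstPart (suc j) Cs))

  sum-take-++-0 : ∀ K xs → sum (take K (xs ++ 0 ∷ [])) ≡ sum (take K xs)
  sum-take-++-0 zero          xs       = refl
  sum-take-++-0 (suc zero)    []       = refl
  sum-take-++-0 (suc (suc K)) []       = refl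
  sum-take-++-0 (suc K)       (x ∷ xs) = cong (λ s → x + s) (sum-take-++-0 K xs)

  length-compositionTable : ∀ K m → length (compositionTable K m) ≡ suc m
  length-compositionTable K zero    = refl
  length-compositionTable K (suc m) = cong suc (length-compositionTable K m)

  lengths-compositionTable : ∀ K m → map length (compositionTable K m) ++ 0 ∷ [] ≡ hist K (suc m)
  lengths-compositionTable K zero    = refl
  lengths-compositionTable K (suc m) = cong₂ _∷_ length-next (lengths-compositionTable K m)
    where
    open ≡-Reasoning
    length-next : length (compositions K (suc m)) ≡ sum (take K (hist K (suc m)))
    length-next = begin
      length (withFirstPart 1 (take K table))          ≡⟨ length-withFirstPart 1 (take K table) ⟩
      sum (map length (take K table))                  ≡⟨ cong sum (take-map K table) ⟨
      sum (take K (map length table))                  ≡⟨ sum-take-++-0 K _ ⟨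
      sum (take K (map length table ++ 0 ∷ []))        ≡⟨ cong (λ xs → sum (take K xs)) (lengths-compositionTable K m) ⟩
      sum (take K (hist K (suc m)))                    ∎
      where
      table : List (List (List ℕ))
      table = compositionTable K m

  length-compositions : ∀ K n → length (compositions K n) ≡ Fℕ K (suc n)
  length-compositions K zero    = refl
  length-compositions K (suc m) = cong headOr0 (lengths-compositionTable K (suc m))

  data Tabulates (K n : ℕ) : ℕ → List (List (List ℕ)) → Set where
    []  : ∀ {j} → Tabulates K n j []
    _∷_ : ∀ {j C Cs} → j ≤ n × Enumerates K (n ∸ j) C → Tabulates K n (suc j) Cs → Tabulates K n j (C ∷ Cs)

  Tabulates-suc : ∀ {K m j Cs} → Tabulates K m j Cs → Tabulates K (suc m) (suc j) Cs
  Tabulates-suc []                    = []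
  Tabulates-suc ((j≤m , enum) ∷ rows) = (s≤s j≤m , enum) ∷ Tabulates-suc rows

  Tabulates-take : ∀ {K n j Cs} r → Tabulates K n j Cs → Tabulates K n j (take r Cs)
  Tabulates-take zero    rows         = []
  Tabulates-take (suc r) []           = []
  Tabulates-take (suc r) (row ∷ rows) = row ∷ Tabulates-take r rows

  ∈-withFirstPart⁻ : ∀ {K n j Cs x} → Tabulates K n j Cs → x ∈ withFirstPart j Cs →
    ∃ λ h → ∃ λ x′ → x ≡ h ∷ x′ × j ≤ h × h < j + length Cs × h ≤ n × IsComposition K (n ∸ h) x′
  ∈-withFirstPart⁻ {j = j} {C ∷ Cs} ((j≤n , _ , sound , _) ∷ rows) x∈ with ∈-++⁻ (map (j ∷_) C) x∈
  ... | inj₁ x∈row = let x′ , x′∈C , x≡j∷x′ = ∈-map⁻ (j ∷_) x∈row in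
    j , x′ , x≡j∷x′ , ≤-refl , subst (j <_) (sym (+-suc j (length Cs))) (s≤s (m≤m+n j _)) , j≤n , sound x′ x′∈C
  ... | inj₂ x∈rest = let h , x′ , x≡h∷x′ , j<h , h<j+1+l , h≤n , comp = ∈-withFirstPart⁻ rows x∈rest in
    h , x′ , x≡h∷x′ , <⇒≤ j<h , subst (h <_) (sym (+-suc j (length Cs))) h<j+1+l , h≤n , comp

  ∈-withFirstPart⁺ : ∀ {K n j Cs h x′} → Tabulates K n j Cs → j ≤ h → h < j + length Cs →
    IsComposition K (n ∸ h) x′ → (h ∷ x′) ∈ withFirstPart j Cs
  ∈-withFirstPart⁺ {j = j} {[]} [] j≤h h<j+0 _ = ⊥-elim (<⇒≱ h<j+0 (subst (_≤ _) (sym (+-identityʳ j)) j≤h))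
  ∈-withFirstPart⁺ {j = j} {C ∷ Cs} {h} {x′} ((_ , _ , _ , complete) ∷ rows) j≤h h<j+l comp
    with m≤n⇒m<n∨m≡n j≤h
  ... | inj₂ refl = ∈-++⁺ˡ (∈-map⁺ (h ∷_) (complete x′ comp))
  ... | inj₁ j<h  = ∈-++⁺ʳ (map (j ∷_) C) (∈-withFirstPart⁺ rows j<h (subst (h <_) (+-suc j (length Cs)) h<j+l) comp)

  withFirstPart-unique : ∀ {K n j Cs} → Tabulates K n j Cs → Unique (withFirstPart j Cs)
  withFirstPart-unique []                                         = []
  withFirstPart-unique {j = j} {C ∷ Cs} ((_ , unique , _) ∷ rows) =
    Unique.++⁺ (Unique.map⁺ (λ { refl → refl }) unique) (withFirstPart-unique rows) disjoint
    where
    disjoint : ∀ {x} → ¬ (x ∈ map (j ∷_) C × x ∈ withFirstPart (suc j) Cs)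
    disjoint (x∈row , x∈rest) with ∈-map⁻ (j ∷_) x∈row | ∈-withFirstPart⁻ rows x∈rest
    ... | _ , _ , refl | _ , _ , refl , j<j , _ = <-irrefl refl j<j

  enumerates-zero : ∀ K → Enumerates K 0 (compositions K 0)
  enumerates-zero K = All.[] ∷ [] , sound , complete
    where
    sound : ∀ x → x ∈ [] ∷ [] → IsComposition K 0 x
    sound x (here refl) = refl
    complete : ∀ x → IsComposition K 0 x → x ∈ [] ∷ []
    complete []      _                     = here refl
    complete (h ∷ x) (1≤h , _ , h≤0 , _) = ⊥-elim (<⇒≱ 1≤h h≤0)

  -- The first part h of a composition of m + 1 satisfies h ≤ K and h ≤ m + 1, and the rest is read off
  -- row h − 1 of the table of m.
  enumerates-withFirstPart : ∀ {K m Cs} → Tabulates K m 0 Cs → length Cs ≡ suc m →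
    Enumerates K (suc m) (withFirstPart 1 (take K Cs))
  enumerates-withFirstPart {K} {m} {Cs} rows length≡ =
    withFirstPart-unique rowsₖ , sound , complete
    where
    rowsₖ : Tabulates K (suc m) 1 (take K Cs)
    rowsₖ = Tabulates-take K (Tabulates-suc rows)
    length-take≡ : length (take K Cs) ≡ K ⊓ suc m
    length-take≡ = trans (length-take K Cs) (cong (K ⊓_) length≡)
    sound : ∀ x → x ∈ withFirstPart 1 (take K Cs) → IsComposition K (suc m) x
    sound x x∈ with ∈-withFirstPart⁻ rowsₖ x∈
    ... | h , x′ , refl , 1≤h , h<1+l , h≤n , comp =
      1≤h , ≤-trans (s≤s⁻¹ (subst (h <_) (cong suc length-take≡) h<1+l)) (m⊓n≤m K (suc m)) , h≤n , comp
    complete : ∀ x → IsComposition K (suc m) x → x ∈ withFirstPart 1 (take K Cs)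
    complete (h ∷ x′) (1≤h , h≤K , h≤n , comp) =
      ∈-withFirstPart⁺ rowsₖ 1≤h (subst (h <_) (cong suc (sym length-take≡)) (s≤s (⊓-glb h≤K h≤n))) comp

  compositionTable-tabulates : ∀ K m → Tabulates K m 0 (compositionTable K m)
  compositionTable-tabulates K zero    = (z≤n , enumerates-zero K) ∷ []
  compositionTable-tabulates K (suc m) =
    (z≤n , enumerates-withFirstPart (compositionTable-tabulates K m) (length-compositionTable K m))
    ∷ Tabulates-suc (compositionTable-tabulates K m)

  compositions-enumerate : ∀ K n → Enumerates K n (compositions K n)
  compositions-enumerate K zero    = enumerates-zero K
  compositions-enumerate K (suc m) =
    enumerates-withFirstPart (compositionTable-tabulates K m) (length-compositionTable K m)

  S-hasCard : ∀ K n → 1 ≤ K → HasCard (Vec (Fin n) n) (InS (suc K) (+ n)) (Fℕ K (suc n))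
  S-hasCard K n 1≤K = subst (HasCard (Vec (Fin n) n) (InS (suc K) (+ n))) (length-compositions K n)
    (HasCard-image (Enumerates⇒HasCard (compositions-enumerate K n)) (layeredPerm n)
      (layeredPerm-injective n) (λ c → layeredPerm-∈S K n c 1≤K) (λ π → Occurrences.S⇒layered π K))

module GeneratingFunction where

  open import Data.Nat using (ℕ; zero; suc; _∸_; _≤_; _<_; z≤n; s≤s; s≤s⁻¹; _<?_)
  open import Data.Nat.Properties using (≤-refl; m≤n⇒m≤1+n; <⇒≱; +-∸-assoc; n∸n≡0)
  open import Data.Nat.ListAction using (sum)
  open import Data.Integer using (ℤ; +_; _+_; _*_; -_)
  open import Data.Integer.Properties
    using (+-identityʳ; +-comm; +-inverseʳ; *-comm; *-identityʳ; *-zeroʳ; -1*i≡-i; pos-+; neg-distrib-+)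
  open import Data.List using (List; []; _∷_; take)
  open import Data.Empty using (⊥-elim)
  open import Relation.Nullary using (yes; no)
  open import Relation.Binary.PropositionalEquality

  weightedSum : (ℕ → ℤ) → List ℕ → ℤ
  weightedSum δ []       = + 0
  weightedSum δ (x ∷ xs) = + x * δ 0 + weightedSum (λ i → δ (suc i)) xs

  sumTo-cong : ∀ n {g g′ : ℕ → ℤ} → (∀ j → j ≤ n → g j ≡ g′ j) → sumTo n g ≡ sumTo n g′
  sumTo-cong zero    g≗g′ = g≗g′ 0 z≤n
  sumTo-cong (suc n) g≗g′ =
    cong₂ _+_ (sumTo-cong n (λ j j≤n → g≗g′ j (m≤n⇒m≤1+n j≤n))) (g≗g′ (suc n) ≤-refl)

  conv-F≡weightedSum-hist : ∀ K n δ → conv (λ j → + Fℕ K (suc j)) δ n ≡ weightedSum δ (hist K (suc n))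
  conv-F≡weightedSum-hist K zero    δ = sym (+-identityʳ _)
  conv-F≡weightedSum-hist K (suc n) δ = begin
    sumTo n (λ j → F₊ j * δ (suc n ∸ j)) + F₊ (suc n) * δ (n ∸ n)
      ≡⟨ cong₂ _+_ shifted (cong (λ i → F₊ (suc n) * δ i) (n∸n≡0 n)) ⟩
    weightedSum (λ i → δ (suc i)) (hist K (suc n)) + F₊ (suc n) * δ 0
      ≡⟨ +-comm (weightedSum (λ i → δ (suc i)) (hist K (suc n))) _ ⟩
    weightedSum δ (hist K (suc (suc n)))
      ∎
    where
    open ≡-Reasoning
    F₊ : ℕ → ℤ
    F₊ j = + Fℕ K (suc j)
    shifted : sumTo n (λ j → F₊ j * δ (suc n ∸ j)) ≡ weightedSum (λ i → δ (suc i)) (hist K (suc n))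
    shifted = trans (sumTo-cong n (λ j j≤n → cong (λ i → F₊ j * δ i) (+-∸-assoc 1 j≤n)))
                    (conv-F≡weightedSum-hist K n (λ i → δ (suc i)))

  weightedSum-prefix : ∀ r δ xs → (∀ i → i < r → δ i ≡ - + 1) → (∀ i → r ≤ i → δ i ≡ + 0) →
    weightedSum δ xs ≡ - + sum (take r xs)
  weightedSum-prefix zero    δ []       _      _    = refl
  weightedSum-prefix (suc r) δ []       _      _    = refl
  weightedSum-prefix zero    δ (x ∷ xs) _      δ≡0 = cong₂ _+_
    (trans (cong (λ d → + x * d) (δ≡0 0 z≤n)) (*-zeroʳ (+ x)))
    (weightedSum-prefix zero (λ i → δ (suc i)) xs (λ i ()) (λ i _ → δ≡0 (suc i) z≤n))
  weightedSum-prefix (suc r) δ (x ∷ xs) δ≡-1 δ≡0 = begin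
    + x * δ 0 + weightedSum (λ i → δ (suc i)) xs  ≡⟨ cong₂ _+_ head rest ⟩
    - + x + - + sum (take r xs)                   ≡⟨ neg-distrib-+ (+ x) (+ sum (take r xs)) ⟨
    - (+ x + + sum (take r xs))                   ≡⟨ cong -_ (pos-+ x (sum (take r xs))) ⟨
    - + sum (take (suc r) (x ∷ xs))               ∎
    where
    open ≡-Reasoning
    head : + x * δ 0 ≡ - + x
    head = trans (cong (λ d → + x * d) (δ≡-1 0 (s≤s z≤n))) (trans (*-comm (+ x) (- + 1)) (-1*i≡-i (+ x)))
    rest : weightedSum (λ i → δ (suc i)) xs ≡ - + sum (take r xs)
    rest = weightedSum-prefix r (λ i → δ (suc i)) xs
      (λ i i<r → δ≡-1 (suc i) (s≤s i<r)) (λ i r≤i → δ≡0 (suc i) (s≤s r≤i))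

  denom-suc-< : ∀ K i → i < K → denom (suc K) (suc i) ≡ - + 1
  denom-suc-< K i i<K with suc i <? suc K
  ... | yes _       = refl
  ... | no  1+i≮1+K = ⊥-elim (1+i≮1+K (s≤s i<K))

  denom-suc-≥ : ∀ K i → K ≤ i → denom (suc K) (suc i) ≡ + 0
  denom-suc-≥ K i K≤i with suc i <? suc K
  ... | yes 1+i<1+K = ⊥-elim (<⇒≱ (s≤s⁻¹ 1+i<1+K) K≤i)
  ... | no  _       = refl

  -- The recurrence F_{K,m+2} = F_{K,m+1} + ⋯ + F_{K,m+2−K} is the vanishing of the coefficient of x^{m+1}.
  F-conv-denom : ∀ K n → conv (λ j → + Fℕ K (suc j)) (denom (suc K)) n ≡ one n
  F-conv-denom K zero    = refl
  F-conv-denom K (suc m) = begin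
    conv (λ j → + Fℕ K (suc j)) (denom (suc K)) (suc m)
      ≡⟨ conv-F≡weightedSum-hist K (suc m) (denom (suc K)) ⟩
    + S * + 1 + weightedSum (λ i → denom (suc K) (suc i)) (hist K (suc m))
      ≡⟨ cong₂ _+_ (*-identityʳ (+ S)) (weightedSum-prefix K _ (hist K (suc m)) (denom-suc-< K) (denom-suc-≥ K)) ⟩
    + S + - + S
      ≡⟨ +-inverseʳ (+ S) ⟩
    + 0
      ∎
    where
    open ≡-Reasoning
    S : ℕ
    S = sum (take K (hist K (suc m)))

open import Data.Nat using (ℕ; _≥_; _∸_; zero; suc; s≤s)
import Data.Nat.Properties as ℕ
open import Data.Integer using (ℤ; +_; -[1+_]; _+_; _*_)
open import Data.Fin using (Fin)
open import Data.Vec using (Vec)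
open import Data.Product using (_×_; _,_)
open import Relation.Binary.PropositionalEquality using (_≡_; cong; subst; trans)
open Enumeration using (S-hasCard; HasCard-⊥; HasCard-unique)
open GeneratingFunction using (sumTo-cong; F-conv-denom)

mainTheorem2 : (k : ℕ) → k ≥ 2 →
    ((n : ℤ) → HasCard (Carrier n) (InS k n) (F (k Data.Nat.∸ 1) (n + + 1)))
    ×
    ((a : ℕ → ℕ) → ((n : ℕ) → HasCard (Carrier (+ n)) (InS k (+ n)) (a n)) →
    (n : ℕ) → conv (λ j → + (a j)) (denom k) n ≡ one n)
mainTheorem2 zero    ()
mainTheorem2 (suc K) (s≤s 1≤K) = counts , generatingFunction
  where
  counts : (n : ℤ) → HasCard (Carrier n) (InS (suc K) n) (F K (n + + 1))
  counts (+ n)          = subst (HasCard (Vec (Fin n) n) (InS (suc K) (+ n))) (cong (Fℕ K) (ℕ.+-comm 1 n))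
                                (S-hasCard K n 1≤K)
  counts -[1+ zero ]    = HasCard-⊥
  counts -[1+ suc _ ]   = HasCard-⊥
  generatingFunction : (a : ℕ → ℕ) → ((n : ℕ) → HasCard (Carrier (+ n)) (InS (suc K) (+ n)) (a n)) →
    (n : ℕ) → conv (λ j → + (a j)) (denom (suc K)) n ≡ one n
  generatingFunction a card n = trans (sumTo-cong n λ j _ → cong (λ m → + m * denom (suc K) (n ∸ j)) (a≡F j))
                                      (F-conv-denom K n)
    where
    a≡F : ∀ j → a j ≡ Fℕ K (suc j)
    a≡F j = HasCard-unique (card j) (S-hasCard K j 1≤K)
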